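{- Let $b_1,\dots,b_6$ be integers with $b_1,b_2,b_5,b_6\ne0$ such that the matrix $$M=\begin{pmatrix} b_1&0&-1&0&0&0\\0&b_2&-1&0&0&0\\-1&-1&b_3&-1&0&0\\0&0&-1&b_4&-1&-1\\0&0&0&-1&b_5&0\\0&0&0&-1&0&b_6\end{pmatrix}$$ is invertible, with inverse $M^{ -1}=(\ell_{jk})_{1\le j,k\le6}$, and let $A:=\begin{pmatrix}\ell_{33}&\ell_{34}\\\ell_{43}&\ell_{44}\end{pmatrix}$. If $\mathbf r=(\varepsilon_1,\varepsilon_2,2n_1+1,2n_2+1,\varepsilon_5,\varepsilon_6)^T$ with $n_1,n_2\in\mathbb Z$ and $\varepsilon_j\in\{\pm1\}$, then $$\tfrac12\mathbf r^TM^{ -1}\mathbf r=\tfrac12(2n_1+2\alpha_1,\,2n_2+2\alpha_2)\,A\begin{pmatrix}2n_1+2\alpha_1\\2n_2+2\alpha_2\end{pmatrix}+c,$$ where $\alpha_1:=\frac12\big(1+\frac{\varepsilon_1}{b_1}+\frac{\varepsilon_2}{b_2}\big)$, $\alpha_2:=\frac12\big(1+\frac{\varepsilon_5}{b_5}+\frac{\varepsilon_6}{b_6}\big)$, and $c:=\frac12\big(\frac1{b_1}+\frac1{b_2}+\frac1{b_5}+\frac1{b_6}\big)$. -}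

module Defs where

open import Data.Nat using (ℕ; zero; suc)
open import Data.Fin using (Fin; zero; suc)
open import Data.Integer using (ℤ)
open import Data.Rational using (ℚ; 0ℚ; 1ℚ; _+_; _*_; -_; _/_; 1/_; _≟_; ≢-nonZero)
open import Relation.Nullary using (yes; no)
open import Relation.Binary.PropositionalEquality using (_≡_)
open import Data.Product using (_×_)

sumFin : (n : ℕ) → (Fin n → ℚ) → ℚ
sumFin zero    f = 0ℚ
sumFin (suc n) f = f zero + sumFin n (λ i → f (suc i))

Matrix : ℕ → Set
Matrix n = Fin n → Fin n → ℚ

_·_ : {n : ℕ} → Matrix n → Matrix n → Matrix n
_·_ {n} P Q i k = sumFin n (λ j → P i j * Q j k)

identity : {n : ℕ} → Matrix n
identity zero    zero    = 1ℚ
identity zero    (suc _) = 0ℚ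
identity (suc _) zero    = 0ℚ
identity (suc i) (suc j) = identity i j

IsInverse : {n : ℕ} → Matrix n → Matrix n → Set
IsInverse M L = (∀ i j → (M · L) i j ≡ identity i j) × (∀ i j → (L · M) i j ≡ identity i j)

quad : {n : ℕ} → Matrix n → (Fin n → ℚ) → ℚ
quad {n} Q r = sumFin n (λ i → sumFin n (λ j → r i * Q i j * r j))

⟦_⟧ : ℤ → ℚ
⟦ z ⟧ = z / 1

-- Reciprocal of a rational, totalised by 1/0 := 0 (only used at nonzero arguments).
inv : ℚ → ℚ
inv p with p ≟ 0ℚ
... | yes _ = 0ℚ
... | no p≢0 = 1/_ p {{≢-nonZero p≢0}}

half : ℚ
half = 1ℤ / 2
  where open Data.Integer using (1ℤ)

-- The 6×6 matrix M(b₁,…,b₆) of the paper (indices 0..5 for 1..6).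
Mmat : (b₁ b₂ b₃ b₄ b₅ b₆ : ℤ) → Matrix 6
Mmat b₁ b₂ b₃ b₄ b₅ b₆ = λ i j → ⟦ entry i j ⟧
  where
  open Data.Integer using (0ℤ; -1ℤ)
  entry : Fin 6 → Fin 6 → ℤ
  entry zero zero = b₁
  entry zero (suc (suc zero)) = -1ℤ
  entry (suc zero) (suc zero) = b₂
  entry (suc zero) (suc (suc zero)) = -1ℤ
  entry (suc (suc zero)) zero = -1ℤ
  entry (suc (suc zero)) (suc zero) = -1ℤ
  entry (suc (suc zero)) (suc (suc zero)) = b₃
  entry (suc (suc zero)) (suc (suc (suc zero))) = -1ℤ
  entry (suc (suc (suc zero))) (suc (suc zero)) = -1ℤ
  entry (suc (suc (suc zero))) (suc (suc (suc zero))) = b₄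
  entry (suc (suc (suc zero))) (suc (suc (suc (suc zero)))) = -1ℤ
  entry (suc (suc (suc zero))) (suc (suc (suc (suc (suc zero))))) = -1ℤ
  entry (suc (suc (suc (suc zero)))) (suc (suc (suc zero))) = -1ℤ
  entry (suc (suc (suc (suc zero)))) (suc (suc (suc (suc zero)))) = b₅
  entry (suc (suc (suc (suc (suc zero))))) (suc (suc (suc zero))) = -1ℤ
  entry (suc (suc (suc (suc (suc zero))))) (suc (suc (suc (suc (suc zero))))) = b₆
  entry _ _ = 0ℤ

rvec : (ε₁ ε₂ n₁ n₂ ε₅ ε₆ : ℤ) → Fin 6 → ℚ
rvec ε₁ ε₂ n₁ n₂ ε₅ ε₆ zero = ⟦ ε₁ ⟧
rvec ε₁ ε₂ n₁ n₂ ε₅ ε₆ (suc zero) = ⟦ ε₂ ⟧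
rvec ε₁ ε₂ n₁ n₂ ε₅ ε₆ (suc (suc zero)) = ⟦ Data.Integer.+ 2 ⟧ * ⟦ n₁ ⟧ + 1ℚ
rvec ε₁ ε₂ n₁ n₂ ε₅ ε₆ (suc (suc (suc zero))) = ⟦ Data.Integer.+ 2 ⟧ * ⟦ n₂ ⟧ + 1ℚ
rvec ε₁ ε₂ n₁ n₂ ε₅ ε₆ (suc (suc (suc (suc zero)))) = ⟦ ε₅ ⟧
rvec ε₁ ε₂ n₁ n₂ ε₅ ε₆ (suc (suc (suc (suc (suc zero))))) = ⟦ ε₆ ⟧

Ablock : Matrix 6 → Matrix 2
Ablock L zero zero = L (suc (suc zero)) (suc (suc zero))
Ablock L zero (suc zero) = L (suc (suc zero)) (suc (suc (suc zero)))
Ablock L (suc zero) zero = L (suc (suc (suc zero))) (suc (suc zero))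
Ablock L (suc zero) (suc zero) = L (suc (suc (suc zero))) (suc (suc (suc zero)))

vec2 : ℚ → ℚ → Fin 2 → ℚ
vec2 x y zero = x
vec2 x y (suc zero) = y

alpha : (ε b ε' b' : ℤ) → ℚ
alpha ε b ε' b' = half * (1ℚ + ⟦ ε ⟧ * inv ⟦ b ⟧ + ⟦ ε' ⟧ * inv ⟦ b' ⟧)

cconst : (b₁ b₂ b₅ b₆ : ℤ) → ℚ
cconst b₁ b₂ b₅ b₆ = half * (inv ⟦ b₁ ⟧ + inv ⟦ b₂ ⟧ + inv ⟦ b₅ ⟧ + inv ⟦ b₆ ⟧)

two : ℚ
two = ⟦ Data.Integer.+ 2 ⟧

{-# OPTIONS --safe #-}
-- At a leaf i of the tree (vertices 1, 2, 5, 6, attached to p = 3, 3, 4, 4) the i-th row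
-- and column of M contain only bᵢ and a −1 at p, so M L = L M = 1 can be solved for the
-- leaf entries of L = M⁻¹: ℓᵢₖ = (δᵢₖ + ℓₚₖ)/bᵢ and ℓⱼᵢ = ℓⱼₚ/bᵢ for j ≠ i. Consequently
-- (Lr)ᵢ = (εᵢ + (Lr)ₚ)/bᵢ at a leaf, while at the inner vertices 3, 4 the vector Lr is Av
-- with v = (r₃ + ε₁/b₁ + ε₂/b₂, r₄ + ε₅/b₅ + ε₆/b₆) = (2n₁ + 2α₁, 2n₂ + 2α₂). Writing
-- rᵀLr = Σ rᵢ (Lr)ᵢ and using εᵢ² = 1, each leaf contributes 1/bᵢ plus the shift εᵢ/bᵢ of
-- the inner coordinate it is attached to, which gives vᵀAv + Σ 1/bᵢ.
module Submission where

open import Defs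
open import Data.Integer using (ℤ; 0ℤ; 1ℤ; -1ℤ)
import Data.Integer as ℤ
import Data.Integer.Properties as ℤ
open import Data.Integer.GCD using (gcd)
open import Data.Rational using (ℚ; 0ℚ; 1ℚ; _+_; _*_; -_; ↥_; ≢-nonZero)
open import Data.Rational.Properties
  using (+-identityˡ; +-identityʳ; *-identityˡ; *-zeroˡ; *-zeroʳ; *-comm; *-assoc;
         *-distribˡ-+; *-inverseˡ; ↥-/; +-0-commutativeMonoid)
import Data.Rational.Properties as ℚ
open import Algebra.Bundles using (CommutativeMonoid)
open import Algebra.Properties.CommutativeSemigroup
  (CommutativeMonoid.commutativeSemigroup +-0-commutativeMonoid) using (interchange)
open import Data.Nat using (zero; suc)
open import Data.Fin using (Fin; zero; suc; #_)
open import Data.Fin.Properties using (suc-injective)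
open import Data.Product using (_×_; _,_; proj₁; proj₂)
open import Data.Sum using (_⊎_; inj₁; inj₂)
open import Function using (_∘_)
open import Relation.Nullary using (contradiction)
open import Relation.Nullary.Decidable using (yes; no)
open import Relation.Binary.PropositionalEquality
open import Data.Rational.Solver using (module +-*-Solver)
open +-*-Solver using (solve; _:+_; _:*_; _:=_; con)
open ≡-Reasoning

sumFin-cong : ∀ n {f g : Fin n → ℚ} → (∀ i → f i ≡ g i) → sumFin n f ≡ sumFin n g
sumFin-cong zero    f≡g = refl
sumFin-cong (suc n) f≡g = cong₂ _+_ (f≡g zero) (sumFin-cong n (f≡g ∘ suc))

sumFin-+ : ∀ n (f g : Fin n → ℚ) →
           sumFin n (λ i → f i + g i) ≡ sumFin n f + sumFin n g
sumFin-+ zero    f g = refl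
sumFin-+ (suc n) f g = begin
  (f zero + g zero) + sumFin n (λ i → f (suc i) + g (suc i))
    ≡⟨ cong ((f zero + g zero) +_) (sumFin-+ n (f ∘ suc) (g ∘ suc)) ⟩
  (f zero + g zero) + (sumFin n (f ∘ suc) + sumFin n (g ∘ suc))
    ≡⟨ interchange (f zero) (g zero) _ _ ⟩
  sumFin (suc n) f + sumFin (suc n) g ∎

sumFin-*ˡ : ∀ n (c : ℚ) (f : Fin n → ℚ) → sumFin n (λ i → c * f i) ≡ c * sumFin n f
sumFin-*ˡ zero    c f = sym (*-zeroʳ c)
sumFin-*ˡ (suc n) c f = trans (cong (c * f zero +_) (sumFin-*ˡ n c (f ∘ suc)))
                              (sym (*-distribˡ-+ c (f zero) _))

sumFin-zero : ∀ n {f : Fin n → ℚ} → (∀ i → f i ≡ 0ℚ) → sumFin n f ≡ 0ℚ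
sumFin-zero zero    f≡0 = refl
sumFin-zero (suc n) f≡0 = cong₂ _+_ (f≡0 zero) (sumFin-zero n (f≡0 ∘ suc))

sumFin-single : ∀ n {f : Fin n → ℚ} (i : Fin n) →
                (∀ j → j ≢ i → f j ≡ 0ℚ) → sumFin n f ≡ f i
sumFin-single (suc n) {f} zero f≡0 =
  trans (cong (f zero +_) (sumFin-zero n (λ j → f≡0 (suc j) λ ()))) (+-identityʳ _)
sumFin-single (suc n) {f} (suc i) f≡0 =
  trans (cong₂ _+_ (f≡0 zero λ ()) (sumFin-single n i (λ j j≢i → f≡0 (suc j) (j≢i ∘ suc-injective))))
        (+-identityˡ _)

sumFin-pair : ∀ n {f : Fin n → ℚ} {i p : Fin n} → i ≢ p →
              (∀ j → j ≢ i → j ≢ p → f j ≡ 0ℚ) → sumFin n f ≡ f i + f p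
sumFin-pair (suc n) {i = zero}  {zero}  i≢p f≡0 = contradiction refl i≢p
sumFin-pair (suc n) {f} {zero}  {suc p} i≢p f≡0 =
  cong (f zero +_) (sumFin-single n p (λ j j≢p → f≡0 (suc j) (λ ()) (j≢p ∘ suc-injective)))
sumFin-pair (suc n) {f} {suc i} {zero}  i≢p f≡0 =
  trans (cong (f zero +_) (sumFin-single n i (λ j j≢i → f≡0 (suc j) (j≢i ∘ suc-injective) (λ ()))))
        (ℚ.+-comm (f zero) (f (suc i)))
sumFin-pair (suc n) {i = suc i} {suc p} i≢p f≡0 =
  trans (cong₂ _+_ (f≡0 zero (λ ()) (λ ()))
                   (sumFin-pair n (i≢p ∘ cong suc)
                      (λ j j≢i j≢p → f≡0 (suc j) (j≢i ∘ suc-injective) (j≢p ∘ suc-injective))))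
        (+-identityˡ _)

infixl 7 _·ᵥ_

_·ᵥ_ : ∀ {n} → Matrix n → (Fin n → ℚ) → Fin n → ℚ
_·ᵥ_ {n} Q r i = sumFin n (λ j → Q i j * r j)

identity-diagonal : ∀ {n} (i : Fin n) → identity i i ≡ 1ℚ
identity-diagonal zero    = refl
identity-diagonal (suc i) = identity-diagonal i

identity-off-diagonal : ∀ {n} {i j : Fin n} → i ≢ j → identity i j ≡ 0ℚ
identity-off-diagonal {i = zero}  {zero}  i≢j = contradiction refl i≢j
identity-off-diagonal {i = zero}  {suc j} i≢j = refl
identity-off-diagonal {i = suc i} {zero}  i≢j = refl
identity-off-diagonal {i = suc i} {suc j} i≢j = identity-off-diagonal (i≢j ∘ cong suc)

identity-·ᵥ : ∀ {n} (r : Fin n → ℚ) (i : Fin n) → (identity ·ᵥ r) i ≡ r i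
identity-·ᵥ {n} r i = begin
  sumFin n (λ j → identity i j * r j)
    ≡⟨ sumFin-single n i (λ j j≢i → trans (cong (_* r j) (identity-off-diagonal (j≢i ∘ sym)))
                                          (*-zeroˡ (r j))) ⟩
  identity i i * r i
    ≡⟨ trans (cong (_* r i) (identity-diagonal i)) (*-identityˡ (r i)) ⟩
  r i ∎

quad-·ᵥ : ∀ {n} (Q : Matrix n) (r : Fin n → ℚ) → quad Q r ≡ sumFin n (λ i → r i * (Q ·ᵥ r) i)
quad-·ᵥ {n} Q r = sumFin-cong n λ i →
  trans (sumFin-cong n (λ j → *-assoc (r i) (Q i j) (r j))) (sumFin-*ˡ n (r i) _)

record IsLeaf {n} (M : Matrix n) (i p : Fin n) : Set where
  field
    distinct       : i ≢ p
    row-link       : M i p ≡ - 1ℚ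
    column-link    : M p i ≡ - 1ℚ
    zero-elsewhere : ∀ j → j ≢ i → j ≢ p → M i j ≡ 0ℚ × M j i ≡ 0ℚ

solve-leaf-equation : ∀ {b β x y δ : ℚ} → β * b ≡ 1ℚ → b * x + - 1ℚ * y ≡ δ → x ≡ β * (δ + y)
solve-leaf-equation {b} {β} {x} {y} {δ} βb≡1 eq = begin
  x                           ≡⟨ sym (*-identityˡ x) ⟩
  1ℚ * x                      ≡⟨ cong (_* x) (sym βb≡1) ⟩
  β * b * x                   ≡⟨ regroup β b x y ⟩
  β * ((b * x + - 1ℚ * y) + y) ≡⟨ cong (λ t → β * (t + y)) eq ⟩
  β * (δ + y)                 ∎
  where
  regroup : ∀ β b x y → β * b * x ≡ β * ((b * x + - 1ℚ * y) + y)
  regroup = solve 4 (λ β b x y → β :* b :* x := β :* ((b :* x :+ con (- 1ℚ) :* y) :+ y)) refl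

module InverseAtLeaf {n} {M L : Matrix n} (inverse : IsInverse M L)
                     {i p : Fin n} (leaf : IsLeaf M i p) {β : ℚ} (βb≡1 : β * M i i ≡ 1ℚ) where
  open IsLeaf leaf

  inverse-leaf-row : ∀ k → L i k ≡ β * (identity i k + L p k)
  inverse-leaf-row k = solve-leaf-equation {M i i} {β} {L i k} {L p k} βb≡1 (begin
    M i i * L i k + - 1ℚ * L p k
      ≡⟨ cong (λ m → M i i * L i k + m * L p k) (sym row-link) ⟩
    M i i * L i k + M i p * L p k
      ≡⟨ sym (sumFin-pair n distinct (λ j j≢i j≢p →
           let (Mij≡0 , _) = zero-elsewhere j j≢i j≢p
           in trans (cong (_* L j k) Mij≡0) (*-zeroˡ (L j k)))) ⟩
    (M · L) i k
      ≡⟨ proj₁ inverse i k ⟩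
    identity i k ∎)

  inverse-leaf-column : ∀ j → j ≢ i → L j i ≡ β * L j p
  inverse-leaf-column j j≢i = trans (solve-leaf-equation {M i i} {β} {L j i} {L j p} βb≡1 (begin
    M i i * L j i + - 1ℚ * L j p
      ≡⟨ cong₂ _+_ (*-comm (M i i) (L j i))
                   (trans (cong (_* L j p) (sym column-link)) (*-comm (M p i) (L j p))) ⟩
    L j i * M i i + L j p * M p i
      ≡⟨ sym (sumFin-pair n distinct (λ k k≢i k≢p →
           let (_ , Mki≡0) = zero-elsewhere k k≢i k≢p
           in trans (cong (L j k *_) Mki≡0) (*-zeroʳ (L j k)))) ⟩
    (L · M) j i
      ≡⟨ proj₂ inverse j i ⟩
    identity j i
      ≡⟨ identity-off-diagonal j≢i ⟩
    0ℚ ∎)) (cong (β *_) (+-identityˡ (L j p)))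

  ·ᵥ-leaf : ∀ r → (L ·ᵥ r) i ≡ β * (r i + (L ·ᵥ r) p)
  ·ᵥ-leaf r = begin
    sumFin n (λ k → L i k * r k)
      ≡⟨ sumFin-cong n (λ k → trans (cong (_* r k) (inverse-leaf-row k))
                                    (distribute β (identity i k) (L p k) (r k))) ⟩
    sumFin n (λ k → β * (identity i k * r k + L p k * r k))
      ≡⟨ sumFin-*ˡ n β _ ⟩
    β * sumFin n (λ k → identity i k * r k + L p k * r k)
      ≡⟨ cong (β *_) (sumFin-+ n _ _) ⟩
    β * ((identity ·ᵥ r) i + (L ·ᵥ r) p)
      ≡⟨ cong (λ t → β * (t + (L ·ᵥ r) p)) (identity-·ᵥ r i) ⟩
    β * (r i + (L ·ᵥ r) p) ∎
    where
    distribute : ∀ β δ ℓ x → β * (δ + ℓ) * x ≡ β * (δ * x + ℓ * x)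
    distribute = solve 4 (λ β δ ℓ x → β :* (δ :+ ℓ) :* x := β :* (δ :* x :+ ℓ :* x)) refl

⟦⟧-nonZero : ∀ {b} → b ≢ 0ℤ → ⟦ b ⟧ ≢ 0ℚ
⟦⟧-nonZero {b} b≢0 ⟦b⟧≡0 = b≢0 (begin
  b                         ≡⟨ sym (↥-/ b 1) ⟩
  ↥ ⟦ b ⟧ ℤ.* gcd b (ℤ.+ 1) ≡⟨ cong (λ q → ↥ q ℤ.* gcd b (ℤ.+ 1)) ⟦b⟧≡0 ⟩
  0ℤ ℤ.* gcd b (ℤ.+ 1)      ≡⟨ ℤ.*-zeroˡ (gcd b (ℤ.+ 1)) ⟩
  0ℤ                        ∎)

inv-inverseˡ : ∀ {p} → p ≢ 0ℚ → inv p * p ≡ 1ℚ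
inv-inverseˡ {p} p≢0 with p ℚ.≟ 0ℚ
... | yes p≡0 = contradiction p≡0 p≢0
... | no  _   = *-inverseˡ p {{≢-nonZero p≢0}}

sign-squared : ∀ {ε} → ε ≡ 1ℤ ⊎ ε ≡ -1ℤ → ⟦ ε ⟧ * ⟦ ε ⟧ ≡ 1ℚ
sign-squared (inj₁ refl) = refl
sign-squared (inj₂ refl) = refl

-- Fin index k stands for vertex k + 1 of the paper.
module _ (b₁ b₂ b₃ b₄ b₅ b₆ : ℤ) where

  Mmat-leaf₁ : IsLeaf (Mmat b₁ b₂ b₃ b₄ b₅ b₆) (# 0) (# 2)
  Mmat-leaf₁ = record
    { distinct       = λ ()
    ; row-link       = refl
    ; column-link    = refl
    ; zero-elsewhere = λ where
        zero                               j≢i _   → contradiction refl j≢i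
        (suc zero)                         _   _   → refl , refl
        (suc (suc zero))                   _   j≢p → contradiction refl j≢p
        (suc (suc (suc zero)))             _   _   → refl , refl
        (suc (suc (suc (suc zero))))       _   _   → refl , refl
        (suc (suc (suc (suc (suc zero))))) _   _   → refl , refl
    }

  Mmat-leaf₂ : IsLeaf (Mmat b₁ b₂ b₃ b₄ b₅ b₆) (# 1) (# 2)
  Mmat-leaf₂ = record
    { distinct       = λ ()
    ; row-link       = refl
    ; column-link    = refl
    ; zero-elsewhere = λ where
        zero                               _   _   → refl , refl
        (suc zero)                         j≢i _   → contradiction refl j≢i
        (suc (suc zero))                   _   j≢p → contradiction refl j≢p
        (suc (suc (suc zero)))             _   _   → refl , refl
        (suc (suc (suc (suc zero))))       _   _   → refl , refl
        (suc (suc (suc (suc (suc zero))))) _   _   → refl , refl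
    }

  Mmat-leaf₅ : IsLeaf (Mmat b₁ b₂ b₃ b₄ b₅ b₆) (# 4) (# 3)
  Mmat-leaf₅ = record
    { distinct       = λ ()
    ; row-link       = refl
    ; column-link    = refl
    ; zero-elsewhere = λ where
        zero                               _   _   → refl , refl
        (suc zero)                         _   _   → refl , refl
        (suc (suc zero))                   _   _   → refl , refl
        (suc (suc (suc zero)))             _   j≢p → contradiction refl j≢p
        (suc (suc (suc (suc zero))))       j≢i _   → contradiction refl j≢i
        (suc (suc (suc (suc (suc zero))))) _   _   → refl , refl
    }

  Mmat-leaf₆ : IsLeaf (Mmat b₁ b₂ b₃ b₄ b₅ b₆) (# 5) (# 3)
  Mmat-leaf₆ = record
    { distinct       = λ ()
    ; row-link       = refl
    ; column-link    = refl
    ; zero-elsewhere = λ where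
        zero                               _   _   → refl , refl
        (suc zero)                         _   _   → refl , refl
        (suc (suc zero))                   _   _   → refl , refl
        (suc (suc (suc zero)))             _   j≢p → contradiction refl j≢p
        (suc (suc (suc (suc zero))))       _   _   → refl , refl
        (suc (suc (suc (suc (suc zero))))) j≢i _   → contradiction refl j≢i
    }

leaf-contribution : ∀ ε β X {t} → ε * ε ≡ 1ℚ → t ≡ β * (ε + X) → ε * t ≡ β + ε * β * X
leaf-contribution ε β X ε²≡1 refl = begin
  ε * (β * (ε + X))     ≡⟨ expand ε β X ⟩
  ε * ε * β + ε * β * X ≡⟨ cong (λ s → s * β + ε * β * X) ε²≡1 ⟩
  1ℚ * β + ε * β * X    ≡⟨ cong (_+ ε * β * X) (*-identityˡ β) ⟩
  β + ε * β * X         ∎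
  where
  expand : ∀ ε β X → ε * (β * (ε + X)) ≡ ε * ε * β + ε * β * X
  expand = solve 3 (λ ε β X → ε :* (β :* (ε :+ X)) := ε :* ε :* β :+ ε :* β :* X) refl

module _ (b₁ b₂ b₃ b₄ b₅ b₆ : ℤ) (b₁≢0 : b₁ ≢ 0ℤ) (b₂≢0 : b₂ ≢ 0ℤ) (b₅≢0 : b₅ ≢ 0ℤ) (b₆≢0 : b₆ ≢ 0ℤ)
         (L : Matrix 6) (inverse : IsInverse (Mmat b₁ b₂ b₃ b₄ b₅ b₆) L) where

  private
    β₁ β₂ β₅ β₆ : ℚ
    β₁ = inv ⟦ b₁ ⟧
    β₂ = inv ⟦ b₂ ⟧
    β₅ = inv ⟦ b₅ ⟧
    β₆ = inv ⟦ b₆ ⟧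

    β₁b₁≡1 : β₁ * ⟦ b₁ ⟧ ≡ 1ℚ
    β₁b₁≡1 = inv-inverseˡ (⟦⟧-nonZero b₁≢0)
    β₂b₂≡1 : β₂ * ⟦ b₂ ⟧ ≡ 1ℚ
    β₂b₂≡1 = inv-inverseˡ (⟦⟧-nonZero b₂≢0)
    β₅b₅≡1 : β₅ * ⟦ b₅ ⟧ ≡ 1ℚ
    β₅b₅≡1 = inv-inverseˡ (⟦⟧-nonZero b₅≢0)
    β₆b₆≡1 : β₆ * ⟦ b₆ ⟧ ≡ 1ℚ
    β₆b₆≡1 = inv-inverseˡ (⟦⟧-nonZero b₆≢0)

    M : Matrix 6
    M = Mmat b₁ b₂ b₃ b₄ b₅ b₆

    leaf₁ : IsLeaf M (# 0) (# 2)
    leaf₁ = Mmat-leaf₁ b₁ b₂ b₃ b₄ b₅ b₆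
    leaf₂ : IsLeaf M (# 1) (# 2)
    leaf₂ = Mmat-leaf₂ b₁ b₂ b₃ b₄ b₅ b₆
    leaf₅ : IsLeaf M (# 4) (# 3)
    leaf₅ = Mmat-leaf₅ b₁ b₂ b₃ b₄ b₅ b₆
    leaf₆ : IsLeaf M (# 5) (# 3)
    leaf₆ = Mmat-leaf₆ b₁ b₂ b₃ b₄ b₅ b₆

    module Leaf₁ = InverseAtLeaf {L = L} inverse leaf₁ {β₁} β₁b₁≡1
    module Leaf₂ = InverseAtLeaf {L = L} inverse leaf₂ {β₂} β₂b₂≡1
    module Leaf₅ = InverseAtLeaf {L = L} inverse leaf₅ {β₅} β₅b₅≡1
    module Leaf₆ = InverseAtLeaf {L = L} inverse leaf₆ {β₆} β₆b₆≡1

  fold-leaves : (Fin 6 → ℚ) → Fin 2 → ℚ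
  fold-leaves r = vec2 (r (# 2) + r (# 0) * β₁ + r (# 1) * β₂) (r (# 3) + r (# 4) * β₅ + r (# 5) * β₆)

  ·ᵥ-away-from-leaves : ∀ r j → j ≢ # 0 → j ≢ # 1 → j ≢ # 4 → j ≢ # 5 →
    (L ·ᵥ r) j ≡ L j (# 2) * fold-leaves r zero + (L j (# 3) * fold-leaves r (# 1) + 0ℚ)
  ·ᵥ-away-from-leaves r j j≢0 j≢1 j≢4 j≢5 =
    trans (cong₂ (λ (x₀ , x₁) (x₄ , x₅) →
                    x₀ * r (# 0) + (x₁ * r (# 1) + (L j (# 2) * r (# 2) + (L j (# 3) * r (# 3) +
                    (x₄ * r (# 4) + (x₅ * r (# 5) + 0ℚ))))))
                 (cong₂ _,_ (Leaf₁.inverse-leaf-column j j≢0)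
                            (Leaf₂.inverse-leaf-column j j≢1))
                 (cong₂ _,_ (Leaf₅.inverse-leaf-column j j≢4)
                            (Leaf₆.inverse-leaf-column j j≢5)))
          (regroup (L j (# 2)) (L j (# 3)) (r (# 0)) (r (# 1)) (r (# 2)) (r (# 3)) (r (# 4)) (r (# 5))
                   β₁ β₂ β₅ β₆)
    where
    regroup : ∀ a₂ a₃ r₀ r₁ r₂ r₃ r₄ r₅ β₁ β₂ β₅ β₆ →
      β₁ * a₂ * r₀ + (β₂ * a₂ * r₁ + (a₂ * r₂ + (a₃ * r₃ + (β₅ * a₃ * r₄ + (β₆ * a₃ * r₅ + 0ℚ)))))
        ≡ a₂ * (r₂ + r₀ * β₁ + r₁ * β₂) + (a₃ * (r₃ + r₄ * β₅ + r₅ * β₆) + 0ℚ)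
    regroup = solve 12 (λ a₂ a₃ r₀ r₁ r₂ r₃ r₄ r₅ β₁ β₂ β₅ β₆ →
      β₁ :* a₂ :* r₀ :+ (β₂ :* a₂ :* r₁ :+ (a₂ :* r₂ :+ (a₃ :* r₃ :+
        (β₅ :* a₃ :* r₄ :+ (β₆ :* a₃ :* r₅ :+ con 0ℚ)))))
      := a₂ :* (r₂ :+ r₀ :* β₁ :+ r₁ :* β₂) :+ (a₃ :* (r₃ :+ r₄ :* β₅ :+ r₅ :* β₆) :+ con 0ℚ)) refl

  quad-fold-leaves : ∀ r →
    r (# 0) * r (# 0) ≡ 1ℚ → r (# 1) * r (# 1) ≡ 1ℚ → r (# 4) * r (# 4) ≡ 1ℚ → r (# 5) * r (# 5) ≡ 1ℚ →
    quad L r ≡ quad (Ablock L) (fold-leaves r) + (β₁ + β₂ + β₅ + β₆)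
  quad-fold-leaves r r₁²≡1 r₂²≡1 r₅²≡1 r₆²≡1 = begin
    quad L r
      ≡⟨ quad-·ᵥ L r ⟩
    sumFin 6 (λ i → r i * (L ·ᵥ r) i)
      ≡⟨ cong₂ (λ (t₀ , t₁) (t₄ , t₅) →
                  t₀ + (t₁ + (r (# 2) * X + (r (# 3) * Y + (t₄ + (t₅ + 0ℚ))))))
               (cong₂ _,_ (leaf-contribution (r (# 0)) β₁ X r₁²≡1 (Leaf₁.·ᵥ-leaf r))
                          (leaf-contribution (r (# 1)) β₂ X r₂²≡1 (Leaf₂.·ᵥ-leaf r)))
               (cong₂ _,_ (leaf-contribution (r (# 4)) β₅ Y r₅²≡1 (Leaf₅.·ᵥ-leaf r))
                          (leaf-contribution (r (# 5)) β₆ Y r₆²≡1 (Leaf₆.·ᵥ-leaf r))) ⟩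
    (β₁ + r (# 0) * β₁ * X) + ((β₂ + r (# 1) * β₂ * X) + (r (# 2) * X + (r (# 3) * Y +
      ((β₅ + r (# 4) * β₅ * Y) + ((β₆ + r (# 5) * β₆ * Y) + 0ℚ)))))
      ≡⟨ collect (r (# 0)) (r (# 1)) (r (# 2)) (r (# 3)) (r (# 4)) (r (# 5)) β₁ β₂ β₅ β₆ X Y ⟩
    fold-leaves r zero * X + (fold-leaves r (# 1) * Y + 0ℚ) + (β₁ + β₂ + β₅ + β₆)
      ≡⟨ cong₂ (λ x y → fold-leaves r zero * x + (fold-leaves r (# 1) * y + 0ℚ) + (β₁ + β₂ + β₅ + β₆))
               (·ᵥ-away-from-leaves r (# 2) (λ ()) (λ ()) (λ ()) (λ ()))
               (·ᵥ-away-from-leaves r (# 3) (λ ()) (λ ()) (λ ()) (λ ())) ⟩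
    sumFin 2 (λ i → fold-leaves r i * (Ablock L ·ᵥ fold-leaves r) i) + (β₁ + β₂ + β₅ + β₆)
      ≡⟨ cong (_+ (β₁ + β₂ + β₅ + β₆)) (sym (quad-·ᵥ (Ablock L) (fold-leaves r))) ⟩
    quad (Ablock L) (fold-leaves r) + (β₁ + β₂ + β₅ + β₆) ∎
    where
    X Y : ℚ
    X = (L ·ᵥ r) (# 2)
    Y = (L ·ᵥ r) (# 3)

    collect : ∀ r₀ r₁ r₂ r₃ r₄ r₅ β₁ β₂ β₅ β₆ X Y →
      (β₁ + r₀ * β₁ * X) + ((β₂ + r₁ * β₂ * X) + (r₂ * X + (r₃ * Y +
        ((β₅ + r₄ * β₅ * Y) + ((β₆ + r₅ * β₆ * Y) + 0ℚ)))))
        ≡ (r₂ + r₀ * β₁ + r₁ * β₂) * X + ((r₃ + r₄ * β₅ + r₅ * β₆) * Y + 0ℚ) + (β₁ + β₂ + β₅ + β₆)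
    collect = solve 12 (λ r₀ r₁ r₂ r₃ r₄ r₅ β₁ β₂ β₅ β₆ X Y →
      (β₁ :+ r₀ :* β₁ :* X) :+ ((β₂ :+ r₁ :* β₂ :* X) :+ (r₂ :* X :+ (r₃ :* Y :+
        ((β₅ :+ r₄ :* β₅ :* Y) :+ ((β₆ :+ r₅ :* β₆ :* Y) :+ con 0ℚ)))))
      := (r₂ :+ r₀ :* β₁ :+ r₁ :* β₂) :* X :+ ((r₃ :+ r₄ :* β₅ :+ r₅ :* β₆) :* Y :+ con 0ℚ)
           :+ (β₁ :+ β₂ :+ β₅ :+ β₆)) refl

double-alpha : ∀ n x y → two * n + two * (half * (1ℚ + x + y)) ≡ two * n + 1ℚ + x + y
double-alpha = solve 3 (λ n x y →
  con two :* n :+ con two :* (con half :* (con 1ℚ :+ x :+ y)) := con two :* n :+ con 1ℚ :+ x :+ y) refl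

lemma5p2 : (b₁ b₂ b₃ b₄ b₅ b₆ : ℤ) → b₁ ≢ 0ℤ → b₂ ≢ 0ℤ → b₅ ≢ 0ℤ → b₆ ≢ 0ℤ →
    (L : Matrix 6) → IsInverse (Mmat b₁ b₂ b₃ b₄ b₅ b₆) L →
    (n₁ n₂ ε₁ ε₂ ε₅ ε₆ : ℤ) →
    (ε₁ ≡ 1ℤ ⊎ ε₁ ≡ -1ℤ) → (ε₂ ≡ 1ℤ ⊎ ε₂ ≡ -1ℤ) →
    (ε₅ ≡ 1ℤ ⊎ ε₅ ≡ -1ℤ) → (ε₆ ≡ 1ℤ ⊎ ε₆ ≡ -1ℤ) →
    half * quad L (rvec ε₁ ε₂ n₁ n₂ ε₅ ε₆)
      ≡ half * quad (Ablock L)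
                    (vec2 (two * ⟦ n₁ ⟧ + two * alpha ε₁ b₁ ε₂ b₂)
                          (two * ⟦ n₂ ⟧ + two * alpha ε₅ b₅ ε₆ b₆))
        + cconst b₁ b₂ b₅ b₆
lemma5p2 b₁ b₂ b₃ b₄ b₅ b₆ b₁≢0 b₂≢0 b₅≢0 b₆≢0 L inverse n₁ n₂ ε₁ ε₂ ε₅ ε₆ ε₁=±1 ε₂=±1 ε₅=±1 ε₆=±1 =
  begin
  half * quad L r
    ≡⟨ cong (half *_) (quad-fold-leaves b₁ b₂ b₃ b₄ b₅ b₆ b₁≢0 b₂≢0 b₅≢0 b₆≢0 L inverse r
         (sign-squared ε₁=±1) (sign-squared ε₂=±1) (sign-squared ε₅=±1) (sign-squared ε₆=±1)) ⟩
  half * (quad (Ablock L) v + _)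
    ≡⟨ *-distribˡ-+ half (quad (Ablock L) v) _ ⟩
  half * quad (Ablock L) v + cconst b₁ b₂ b₅ b₆
    ≡⟨ cong (λ v → half * quad (Ablock L) v + cconst b₁ b₂ b₅ b₆)
            (cong₂ vec2 (sym (double-alpha ⟦ n₁ ⟧ (⟦ ε₁ ⟧ * inv ⟦ b₁ ⟧) (⟦ ε₂ ⟧ * inv ⟦ b₂ ⟧)))
                        (sym (double-alpha ⟦ n₂ ⟧ (⟦ ε₅ ⟧ * inv ⟦ b₅ ⟧) (⟦ ε₆ ⟧ * inv ⟦ b₆ ⟧)))) ⟩
  half * quad (Ablock L) (vec2 (two * ⟦ n₁ ⟧ + two * alpha ε₁ b₁ ε₂ b₂)
                               (two * ⟦ n₂ ⟧ + two * alpha ε₅ b₅ ε₆ b₆))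
    + cconst b₁ b₂ b₅ b₆ ∎
  where
  r : Fin 6 → ℚ
  r = rvec ε₁ ε₂ n₁ n₂ ε₅ ε₆
  v : Fin 2 → ℚ
  v = fold-leaves b₁ b₂ b₃ b₄ b₅ b₆ b₁≢0 b₂≢0 b₅≢0 b₆≢0 L inverse r
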